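{- Throw $n$ balls into $n$ bins, each ball independently and uniformly at random. Let $L_j$ be the load of the $j$-th most loaded bin and $N_k:=\sum_{j\le k}L_j$. There exist absolute constants $C_0>0$ and $c>0$ such that for all $n$ and all integers $1\le k\le C_0 n$, $$\mathbb{E}[N_k]\ge c\cdot k\cdot\frac{\log(n/k)}{\log\log(n/k)}.$$ -}

module Defs where

open import Data.Nat using (ℕ; zero; suc; _+_; _*_; _≤_; _/_)
open import Data.Nat.Properties using (≤-decTotalOrder)
open import Data.Nat.Logarithm using (⌊log₂_⌋)
open import Data.Fin using (Fin; zero; suc)
open import Data.Vec using (Vec; []; _∷_; replicate; updateAt; toList)
open import Data.List using (List; []; _∷_; map; concatMap; allFin; take; reverse)
open import Data.Nat.ListAction using (sum)
open import Data.List.Sort.MergeSort ≤-decTotalOrder using (sort)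

-- All n^m outcomes of throwing m (labelled) balls into n bins:
-- an outcome assigns to each ball its bin. Each outcome has probability 1/n^m.
outcomes : (m n : ℕ) → List (Vec (Fin n) m)
outcomes zero    n = [] ∷ []
outcomes (suc m) n = concatMap (λ b → map (b ∷_) (outcomes m n)) (allFin n)

loads : ∀ {m n} → Vec (Fin n) m → Vec ℕ n
loads {n = n} []      = replicate n 0
loads         (b ∷ bs) = updateAt (loads bs) b suc

topSum : ∀ {m n} → ℕ → Vec (Fin n) m → ℕ
topSum k bs = sum (take k (reverse (sort (toList (loads bs)))))

-- Σ over all outcomes of N_k, so that E[N_k] = totalTopSum n k / n^n
totalTopSum : ℕ → ℕ → ℕ
totalTopSum n k = sum (map (topSum k) (outcomes n n))

-- ℓ(n,k) = ⌊log₂ ⌊n/k⌋⌋  (stands in for log(n/k); k = 0 is excluded by hypothesis)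
logRatio : ℕ → ℕ → ℕ
logRatio n zero    = 0
logRatio n (suc k) = ⌊log₂ (n / suc k) ⌋

-- ⌊log₂ ℓ(n,k)⌋  (stands in for log log(n/k))
logLogRatio : ℕ → ℕ → ℕ
logLogRatio n k = ⌊log₂ (logRatio n k) ⌋

module Submission where

-- Probabilities are handled as counts: total m n f sums f over all n^m outcomes.
-- Fix a threshold t with t! = 16u and 2t² ≤ n, and the first N = k·u bins.  Let X be
-- the number of these bins with load ≥ t.  Since N_k ≥ t·min(k, X) pointwise
-- (topSum-≥), it suffices that E[min(k, X)] ≥ k/512, which is a second-moment argument:
--   * a fixed bin has load exactly t with probability C(n,t)(n-1)^(n-t)/n^n ≥ 1/(16·t!)
--     (pointMass-bound, tail-lower), so E[X] ≥ N/(16·t!);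
--   * two distinct bins both have load ≥ t with probability ≤ C(n,t)²/n^(2t) ≤ 1/t!²
--     (jointTail-bound, pair-upper), so the number of such ordered pairs has mean ≤ N²/t!²;
--   * 2kX + X ≤ 2k·min(k, X) + X² and X² = X + #pairs give E[min(k, X)] ≥ k/512.
-- Both probability estimates are proved by induction on the number of balls, splitting
-- on the bin of the first ball.  Finally, for m = ⌊n/k⌋ ≥ 2^128, the choice
-- t = ⌊ℓ/(2ℓ₂)⌋ with ℓ = ⌊log₂ m⌋, ℓ₂ = ⌊log₂ ℓ⌋ gives t! ≤ m and ℓ ≤ 4ℓ₂t, hence
-- E[N_k] ≥ t·k/512 ≥ k·ℓ/(2048·ℓ₂), which is lemma5 with C₀ = 2^-128 and c = 1/2048.

open import Defs
open import Data.Nat using (ℕ; zero; suc; pred; _+_; _*_; _^_; _∸_; _⊓_; _≤_; _<_; z≤n; s≤s; _≤?_; _!; _/_; _%_; NonZero; >-nonZero; ⌊_/2⌋)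
open import Data.Nat.Properties
open import Data.Nat.Tactic.RingSolver using (solve-∀)
open import Data.Nat.Combinatorics using (_C_; nCk+nC[k+1]≡[n+1]C[k+1]; nCk≡nPk/k!)
open import Data.Nat.Combinatorics.Base using (_P_; _P′_)
open import Data.Nat.Combinatorics.Specification using (nPk≡n!/[n∸k]!; nP′k≡n!/[n∸k]!; k!∣nP′k; nP′n≡n!)
open import Data.Nat.Logarithm using (⌊log₂_⌋)
open import Data.Nat.Logarithm.Core using (⌊log2⌋)
open import Data.Nat.Induction using (<-wellFounded)
open import Induction.WellFounded using (Acc; acc)
open import Data.Product using (Σ; _×_; _,_; proj₁; proj₂)
open import Data.Unit using (tt)
open import Data.Nat.DivMod using (m/n*n≡m; m/n*n≤m; m/n≤m; m*n/n≡m; /-monoˡ-≤; m≡m%n+[m/n]*n; m%n<n)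
open import Data.Nat.Divisibility using (divides; m≤n⇒m!∣n!)
open import Algebra.Properties.CommutativeSemigroup +-commutativeSemigroup using () renaming (interchange to +-interchange)
open import Data.Fin using (Fin; toℕ) renaming (zero to fzero; suc to fsuc)
open import Data.Vec using (Vec; []; _∷_; updateAt; toList)
open import Data.List using (List; []; _∷_; map; concatMap; allFin; tabulate; take; reverse; _++_)
open import Data.List.Relation.Unary.All using (All; []; _∷_)
open import Data.List.Relation.Unary.All.Properties using (++⁺)
import Data.List.Relation.Unary.Linked as Linked
open import Data.List.Relation.Unary.Linked using (Linked)
open import Data.List.Relation.Unary.Linked.Properties using (Linked⇒All)
open import Data.List.Relation.Binary.Permutation.Propositional using (_↭_)
open import Data.List.Relation.Binary.Permutation.Propositional.Properties using (↭-reverse) renaming (map⁺ to ↭-map⁺)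
open import Data.List.Sort.MergeSort ≤-decTotalOrder using (sort)
open import Data.List.Sort.MergeSort.Properties ≤-decTotalOrder using (sort-↭; sort-↗)
open import Data.List.Properties using (map-++; map-∘; map-tabulate; unfold-reverse)
open import Data.Nat.ListAction using (sum)
open import Data.Nat.ListAction.Properties using (sum-++; sum-↭)
open import Data.Empty using (⊥-elim)
open import Relation.Nullary using (¬_; yes; no)
open import Relation.Binary.PropositionalEquality using (_≡_; refl; sym; trans; cong; cong₂; subst; module ≡-Reasoning)

sumBelow : ℕ → (ℕ → ℕ) → ℕ
sumBelow zero    f = 0
sumBelow (suc N) f = f 0 + sumBelow N (λ i → f (suc i))

syntax sumBelow N (λ i → e) = ∑[ i < N ] e

sumBelow-cong : ∀ N {f g : ℕ → ℕ} → (∀ i → f i ≡ g i) → sumBelow N f ≡ sumBelow N g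
sumBelow-cong zero    f≡g = refl
sumBelow-cong (suc N) f≡g = cong₂ _+_ (f≡g 0) (sumBelow-cong N (λ i → f≡g (suc i)))

sumBelow-mono : ∀ N {f g : ℕ → ℕ} → (∀ i → f i ≤ g i) → sumBelow N f ≤ sumBelow N g
sumBelow-mono zero    f≤g = z≤n
sumBelow-mono (suc N) f≤g = +-mono-≤ (f≤g 0) (sumBelow-mono N (λ i → f≤g (suc i)))

sumBelow-const : ∀ N c → ∑[ i < N ] c ≡ N * c
sumBelow-const zero    c = refl
sumBelow-const (suc N) c = cong (c +_) (sumBelow-const N c)

sumBelow-+ : ∀ N (f g : ℕ → ℕ) → ∑[ i < N ] (f i + g i) ≡ sumBelow N f + sumBelow N g
sumBelow-+ zero    f g = refl
sumBelow-+ (suc N) f g =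
  trans (cong (f 0 + g 0 +_) (sumBelow-+ N _ _)) (+-interchange (f 0) (g 0) _ _)

sumBelow-*ˡ : ∀ N c (f : ℕ → ℕ) → ∑[ i < N ] (c * f i) ≡ c * sumBelow N f
sumBelow-*ˡ zero    c f = sym (*-zeroʳ c)
sumBelow-*ˡ (suc N) c f =
  trans (cong (c * f 0 +_) (sumBelow-*ˡ N c _)) (sym (*-distribˡ-+ c (f 0) _))

sumBelow-≥ : ∀ N c (f : ℕ → ℕ) → (∀ i → i < N → c ≤ f i) → N * c ≤ sumBelow N f
sumBelow-≥ zero    c f c≤f = z≤n
sumBelow-≥ (suc N) c f c≤f =
  +-mono-≤ (c≤f 0 (s≤s z≤n)) (sumBelow-≥ N c _ (λ i i<N → c≤f (suc i) (s≤s i<N)))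

sumBelow-≥-split : ∀ N j → j < suc N → ∀ A B (f : ℕ → ℕ) →
                   A ≤ f j → (∀ i → ¬ i ≡ j → B ≤ f i) → A + N * B ≤ sumBelow (suc N) f
sumBelow-≥-split N       zero    _ A B f A≤ B≤ =
  +-mono-≤ A≤ (sumBelow-≥ N B _ (λ i _ → B≤ (suc i) (λ ())))
sumBelow-≥-split (suc N) (suc j) (s≤s j<) A B f A≤ B≤ = begin
  A + suc N * B           ≡⟨ +-comm A (B + N * B) ⟩
  B + N * B + A           ≡⟨ +-assoc B (N * B) A ⟩
  B + (N * B + A)         ≡⟨ cong (B +_) (+-comm (N * B) A) ⟩
  B + (A + N * B)         ≤⟨ +-mono-≤ (B≤ 0 (λ ())) rest ⟩
  sumBelow (suc (suc N)) f ∎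
  where
  open ≤-Reasoning
  rest : A + N * B ≤ sumBelow (suc N) (λ i → f (suc i))
  rest = sumBelow-≥-split N j j< A B _ A≤ (λ i i≢j → B≤ (suc i) (λ eq → i≢j (suc-injective eq)))

-- Indicators 𝟙[ a ≤ x ] and 𝟙[ a ≡ x ], defined by recursion so that they
-- compute on numerals.

𝟙[_≤_] : ℕ → ℕ → ℕ
𝟙[ zero  ≤ x     ] = 1
𝟙[ suc a ≤ zero  ] = 0
𝟙[ suc a ≤ suc x ] = 𝟙[ a ≤ x ]

𝟙[_≡_] : ℕ → ℕ → ℕ
𝟙[ zero  ≡ zero  ] = 1
𝟙[ zero  ≡ suc x ] = 0
𝟙[ suc a ≡ zero  ] = 0
𝟙[ suc a ≡ suc x ] = 𝟙[ a ≡ x ]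

𝟙≤-yes : ∀ a x → a ≤ x → 𝟙[ a ≤ x ] ≡ 1
𝟙≤-yes zero    x       _         = refl
𝟙≤-yes (suc a) (suc x) (s≤s a≤x) = 𝟙≤-yes a x a≤x

𝟙≤-no : ∀ a x → ¬ a ≤ x → 𝟙[ a ≤ x ] ≡ 0
𝟙≤-no zero    x       a≰x = ⊥-elim (a≰x z≤n)
𝟙≤-no (suc a) zero    a≰x = refl
𝟙≤-no (suc a) (suc x) a≰x = 𝟙≤-no a x (λ a≤x → a≰x (s≤s a≤x))

𝟙≤-≤1 : ∀ a x → 𝟙[ a ≤ x ] ≤ 1
𝟙≤-≤1 zero    x       = ≤-refl
𝟙≤-≤1 (suc a) zero    = z≤n
𝟙≤-≤1 (suc a) (suc x) = 𝟙≤-≤1 a x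

𝟙≡-refl : ∀ a → 𝟙[ a ≡ a ] ≡ 1
𝟙≡-refl zero    = refl
𝟙≡-refl (suc a) = 𝟙≡-refl a

𝟙≡-yes : ∀ {a x} → a ≡ x → 𝟙[ a ≡ x ] ≡ 1
𝟙≡-yes {a} refl = 𝟙≡-refl a

𝟙≡-no : ∀ a x → ¬ a ≡ x → 𝟙[ a ≡ x ] ≡ 0
𝟙≡-no zero    zero    a≢x = ⊥-elim (a≢x refl)
𝟙≡-no zero    (suc x) a≢x = refl
𝟙≡-no (suc a) zero    a≢x = refl
𝟙≡-no (suc a) (suc x) a≢x = 𝟙≡-no a x (λ eq → a≢x (cong suc eq))

𝟙≡≤𝟙≤ : ∀ a x → 𝟙[ a ≡ x ] ≤ 𝟙[ a ≤ x ]
𝟙≡≤𝟙≤ zero    zero    = ≤-refl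
𝟙≡≤𝟙≤ zero    (suc x) = z≤n
𝟙≡≤𝟙≤ (suc a) zero    = z≤n
𝟙≡≤𝟙≤ (suc a) (suc x) = 𝟙≡≤𝟙≤ a x

-- Raising x by one turns the test a ≤ x + 1 into the test a - 1 ≤ x; the
-- factor 𝟙[ 1 ≤ a ] records that for a = 0 nothing changes.
𝟙≤-suc : ∀ a x → 𝟙[ a ≤ suc x ] ≤ 𝟙[ 1 ≤ a ] * 𝟙[ pred a ≤ x ] + 𝟙[ a ≤ x ]
𝟙≤-suc zero    x = ≤-refl
𝟙≤-suc (suc a) x = ≤-trans (≤-reflexive (sym (+-identityʳ 𝟙[ a ≤ x ]))) (m≤m+n _ _)

𝟙≤-suc-* : ∀ a x y → 𝟙[ a ≤ suc x ] * y ≤ 𝟙[ 1 ≤ a ] * (𝟙[ pred a ≤ x ] * y) + 𝟙[ a ≤ x ] * y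
𝟙≤-suc-* a x y = ≤-trans (*-monoˡ-≤ y (𝟙≤-suc a x))
  (≤-reflexive (trans (*-distribʳ-+ y (𝟙[ 1 ≤ a ] * 𝟙[ pred a ≤ x ]) _) (cong (_+ 𝟙[ a ≤ x ] * y) (*-assoc 𝟙[ 1 ≤ a ] _ y))))

𝟙≡-suc : ∀ a x → 𝟙[ a ≡ suc x ] ≡ 𝟙[ 1 ≤ a ] * 𝟙[ pred a ≡ x ]
𝟙≡-suc zero    x = refl
𝟙≡-suc (suc a) x = sym (+-identityʳ _)

sumBelow-𝟙≡ : ∀ N j → ∑[ i < N ] 𝟙[ i ≡ j ] ≤ 1
sumBelow-𝟙≡ zero    j       = z≤n
sumBelow-𝟙≡ (suc N) zero    = ≤-reflexive (cong suc (trans (sumBelow-const N 0) (*-zeroʳ N)))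
sumBelow-𝟙≡ (suc N) (suc j) = sumBelow-𝟙≡ N j

sumBelow-𝟙≡-* : ∀ N j X → ∑[ i < N ] (𝟙[ i ≡ j ] * X) ≤ X
sumBelow-𝟙≡-* N j X = begin
  ∑[ i < N ] (𝟙[ i ≡ j ] * X) ≡⟨ sumBelow-cong N (λ i → *-comm 𝟙[ i ≡ j ] X) ⟩
  ∑[ i < N ] (X * 𝟙[ i ≡ j ]) ≡⟨ sumBelow-*ˡ N X (λ i → 𝟙[ i ≡ j ]) ⟩
  X * ∑[ i < N ] 𝟙[ i ≡ j ]   ≤⟨ *-monoʳ-≤ X (sumBelow-𝟙≡ N j) ⟩
  X * 1                       ≡⟨ *-identityʳ X ⟩
  X                           ∎
  where open ≤-Reasoning

sumOver : ∀ {A : Set} → List A → (A → ℕ) → ℕ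
sumOver xs f = sum (map f xs)

sumOver-cong : ∀ {A : Set} (xs : List A) {f g : A → ℕ} → (∀ x → f x ≡ g x) → sumOver xs f ≡ sumOver xs g
sumOver-cong []       f≡g = refl
sumOver-cong (x ∷ xs) f≡g = cong₂ _+_ (f≡g x) (sumOver-cong xs f≡g)

sumOver-mono : ∀ {A : Set} (xs : List A) {f g : A → ℕ} → (∀ x → f x ≤ g x) → sumOver xs f ≤ sumOver xs g
sumOver-mono []       f≤g = z≤n
sumOver-mono (x ∷ xs) f≤g = +-mono-≤ (f≤g x) (sumOver-mono xs f≤g)

sumOver-+ : ∀ {A : Set} (xs : List A) (f g : A → ℕ) → sumOver xs (λ x → f x + g x) ≡ sumOver xs f + sumOver xs g
sumOver-+ []       f g = refl
sumOver-+ (x ∷ xs) f g =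
  trans (cong (f x + g x +_) (sumOver-+ xs f g)) (+-interchange (f x) (g x) _ _)

sumOver-*ˡ : ∀ {A : Set} (xs : List A) c (f : A → ℕ) → sumOver xs (λ x → c * f x) ≡ c * sumOver xs f
sumOver-*ˡ []       c f = sym (*-zeroʳ c)
sumOver-*ˡ (x ∷ xs) c f =
  trans (cong (c * f x +_) (sumOver-*ˡ xs c f)) (sym (*-distribˡ-+ c (f x) _))

sumOver-sumBelow : ∀ {A : Set} (xs : List A) N (f : A → ℕ → ℕ) →
                   sumOver xs (λ x → sumBelow N (f x)) ≡ ∑[ i < N ] (sumOver xs (λ x → f x i))
sumOver-sumBelow xs zero    f = sumOver-*ˡ xs 0 (λ _ → 0)
sumOver-sumBelow xs (suc N) f =
  trans (sumOver-+ xs (λ x → f x 0) (λ x → sumBelow N (λ i → f x (suc i))))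
        (cong (sumOver xs (λ x → f x 0) +_) (sumOver-sumBelow xs N (λ x i → f x (suc i))))

sumOver-concatMap : ∀ {A B : Set} (xs : List A) (g : A → List B) (f : B → ℕ) →
                    sumOver (concatMap g xs) f ≡ sumOver xs (λ x → sumOver (g x) f)
sumOver-concatMap []       g f = refl
sumOver-concatMap (x ∷ xs) g f =
  trans (cong sum (map-++ f (g x) (concatMap g xs)))
        (trans (sum-++ (map f (g x)) _) (cong (sumOver (g x) f +_) (sumOver-concatMap xs g f)))

sumFin-≤ : ∀ n (g : Fin n → ℕ) (h : ℕ → ℕ) → (∀ b → g b ≤ h (toℕ b)) → sum (tabulate g) ≤ sumBelow n h
sumFin-≤ zero    g h g≤h = z≤n
sumFin-≤ (suc n) g h g≤h = +-mono-≤ (g≤h fzero) (sumFin-≤ n _ _ (λ b → g≤h (fsuc b)))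

sumFin-≥ : ∀ n (g : Fin n → ℕ) (h : ℕ → ℕ) → (∀ b → h (toℕ b) ≤ g b) → sumBelow n h ≤ sum (tabulate g)
sumFin-≥ zero    g h h≤g = z≤n
sumFin-≥ (suc n) g h h≤g = +-mono-≤ (h≤g fzero) (sumFin-≥ n _ _ (λ b → h≤g (fsuc b)))

-- total m n f sums f over all n^m outcomes of throwing m balls into n bins,
-- so that E[f] = total m n f / n^m.
total : ∀ m n → (Vec (Fin n) m → ℕ) → ℕ
total m n f = sumOver (outcomes m n) f

total-step : ∀ m n (f : Vec (Fin n) (suc m) → ℕ) →
             total (suc m) n f ≡ sum (tabulate (λ b → total m n (λ ω → f (b ∷ ω))))
total-step m n f = begin
  total (suc m) n f
    ≡⟨ sumOver-concatMap (allFin n) (λ b → map (b ∷_) (outcomes m n)) f ⟩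
  sumOver (allFin n) (λ b → sumOver (map (b ∷_) (outcomes m n)) f)
    ≡⟨ sumOver-cong (allFin n) (λ b → cong sum (sym (map-∘ (outcomes m n)))) ⟩
  sumOver (allFin n) (λ b → total m n (λ ω → f (b ∷ ω)))
    ≡⟨ cong sum (map-tabulate (λ b → b) (λ b → total m n (λ ω → f (b ∷ ω)))) ⟩
  sum (tabulate (λ b → total m n (λ ω → f (b ∷ ω)))) ∎
  where open ≡-Reasoning

total-cong : ∀ m n {f g : Vec (Fin n) m → ℕ} → (∀ ω → f ω ≡ g ω) → total m n f ≡ total m n g
total-cong m n = sumOver-cong (outcomes m n)

total-mono : ∀ m n {f g : Vec (Fin n) m → ℕ} → (∀ ω → f ω ≤ g ω) → total m n f ≤ total m n g
total-mono m n = sumOver-mono (outcomes m n)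

total-scale : ∀ m n c (f : Vec (Fin n) m → ℕ) → total m n (λ ω → c * f ω) ≡ c * total m n f
total-scale m n = sumOver-*ˡ (outcomes m n)

total-linear : ∀ m n c (f g : Vec (Fin n) m → ℕ) →
               total m n (λ ω → c * f ω + g ω) ≡ c * total m n f + total m n g
total-linear m n c f g =
  trans (sumOver-+ (outcomes m n) (λ ω → c * f ω) g) (cong (_+ total m n g) (total-scale m n c f))

-- entry v i is the i-th entry of v (0 past the end); load ω i is the load of bin i.
entry : ∀ {n} → Vec ℕ n → ℕ → ℕ
entry []      i       = 0
entry (x ∷ v) zero    = x
entry (x ∷ v) (suc i) = entry v i

load : ∀ {m n} → Vec (Fin n) m → ℕ → ℕ
load ω i = entry (loads ω) i

load-empty : ∀ n i → load {0} {n} [] i ≡ 0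
load-empty zero    i       = refl
load-empty (suc n) zero    = refl
load-empty (suc n) (suc i) = load-empty n i

load-hit : ∀ {m n} (b : Fin n) (ω : Vec (Fin n) m) i → toℕ b ≡ i → load (b ∷ ω) i ≡ suc (load ω i)
load-hit b ω _ refl = go (loads ω) b
  where
  go : ∀ {n} (v : Vec ℕ n) b → entry (updateAt v b suc) (toℕ b) ≡ suc (entry v (toℕ b))
  go (x ∷ v) fzero    = refl
  go (x ∷ v) (fsuc b) = go v b

load-miss : ∀ {m n} (b : Fin n) (ω : Vec (Fin n) m) i → ¬ toℕ b ≡ i → load (b ∷ ω) i ≡ load ω i
load-miss b ω i b≢i = go (loads ω) b i b≢i
  where
  go : ∀ {n} (v : Vec ℕ n) b i → ¬ toℕ b ≡ i → entry (updateAt v b suc) i ≡ entry v i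
  go (x ∷ v) fzero    zero    b≢i = ⊥-elim (b≢i refl)
  go (x ∷ v) fzero    (suc i) b≢i = refl
  go (x ∷ v) (fsuc b) zero    b≢i = refl
  go (x ∷ v) (fsuc b) (suc i) b≢i = go v b i (λ eq → b≢i (cong suc eq))

load-cons : ∀ {m n} (b : Fin n) (ω : Vec (Fin n) m) i → load (b ∷ ω) i ≡ 𝟙[ toℕ b ≡ i ] + load ω i
load-cons b ω i with toℕ b ≟ i
... | yes b≡i = trans (load-hit b ω i b≡i) (cong (_+ load ω i) (sym (𝟙≡-yes b≡i)))
... | no  b≢i = trans (load-miss b ω i b≢i) (cong (_+ load ω i) (sym (𝟙≡-no (toℕ b) i b≢i)))

-- Pascal's rule for binomial coefficients, in a form uniform in a.
C-pascal : ∀ m a → suc m C a ≡ m C a + 𝟙[ 1 ≤ a ] * (m C pred a)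
C-pascal m zero    = refl
C-pascal m (suc a) = begin
  suc m C suc a           ≡⟨ nCk+nC[k+1]≡[n+1]C[k+1] m a ⟨
  m C a + m C suc a       ≡⟨ +-comm (m C a) (m C suc a) ⟩
  m C suc a + m C a       ≡⟨ cong (m C suc a +_) (+-identityʳ (m C a)) ⟨
  m C suc a + 1 * (m C a) ∎
  where open ≡-Reasoning

C*!≡P′ : ∀ {n t} → t ≤ n → (n C t) * t ! ≡ n P′ t
C*!≡P′ {n} {t} t≤n = begin
  (n C t) * t !       ≡⟨ cong (_* t !) (nCk≡nPk/k! t≤n) ⟩
  (n P t) / t ! * t ! ≡⟨ cong (λ x → x / t ! * t !) (trans (nPk≡n!/[n∸k]! t≤n) (sym (nP′k≡n!/[n∸k]! t≤n))) ⟩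
  (n P′ t) / t ! * t ! ≡⟨ m/n*n≡m (k!∣nP′k t≤n) ⟩
  n P′ t              ∎
  where
  open ≡-Reasoning
  instance _ = t !≢0

P′-upper : ∀ n t → n P′ t ≤ n ^ t
P′-upper n zero    = ≤-refl
P′-upper n (suc t) = *-mono-≤ (m∸n≤m n t) (P′-upper n t)

P′-lower : ∀ n t → (n ∸ t) ^ t ≤ n P′ t
P′-lower n zero    = ≤-refl
P′-lower n (suc t) = *-mono-≤ n∸1+t≤n∸t (≤-trans (^-monoˡ-≤ t n∸1+t≤n∸t) (P′-lower n t))
  where
  n∸1+t≤n∸t : n ∸ suc t ≤ n ∸ t
  n∸1+t≤n∸t = ∸-monoʳ-≤ n (n≤1+n t)

C*!-lower : ∀ {n t} → t ≤ n → (n ∸ t) ^ t ≤ (n C t) * t !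
C*!-lower {n} {t} t≤n = ≤-trans (P′-lower n t) (≤-reflexive (sym (C*!≡P′ t≤n)))

C*!-upper : ∀ {n t} → t ≤ n → (n C t) * t ! ≤ n ^ t
C*!-upper {n} {t} t≤n = ≤-trans (≤-reflexive (C*!≡P′ t≤n)) (P′-upper n t)

jointTail : (n i i′ m a b : ℕ) → ℕ
jointTail n i i′ m a b = total m n (λ ω → 𝟙[ a ≤ load ω i ] * 𝟙[ b ≤ load ω i′ ])

jointTail-swap : ∀ n i i′ m a b → jointTail n i i′ m a b ≡ jointTail n i′ i m b a
jointTail-swap n i i′ m a b = total-cong m n (λ ω → *-comm 𝟙[ a ≤ load ω i ] _)

jointTail-hit : ∀ n i i′ m a b (b₀ : Fin n) → toℕ b₀ ≡ i → ¬ toℕ b₀ ≡ i′ →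
                total m n (λ ω → 𝟙[ a ≤ load (b₀ ∷ ω) i ] * 𝟙[ b ≤ load (b₀ ∷ ω) i′ ])
                  ≤ 𝟙[ 1 ≤ a ] * jointTail n i i′ m (pred a) b + jointTail n i i′ m a b
jointTail-hit n i i′ m a b b₀ b₀≡i b₀≢i′ = begin
  total m n (λ ω → 𝟙[ a ≤ load (b₀ ∷ ω) i ] * 𝟙[ b ≤ load (b₀ ∷ ω) i′ ])
    ≡⟨ total-cong m n (λ ω → cong₂ (λ x y → 𝟙[ a ≤ x ] * 𝟙[ b ≤ y ]) (load-hit b₀ ω i b₀≡i) (load-miss b₀ ω i′ b₀≢i′)) ⟩
  total m n (λ ω → 𝟙[ a ≤ suc (load ω i) ] * 𝟙[ b ≤ load ω i′ ])
    ≤⟨ total-mono m n (λ ω → 𝟙≤-suc-* a (load ω i) 𝟙[ b ≤ load ω i′ ]) ⟩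
  total m n (λ ω → 𝟙[ 1 ≤ a ] * (𝟙[ pred a ≤ load ω i ] * 𝟙[ b ≤ load ω i′ ]) + 𝟙[ a ≤ load ω i ] * 𝟙[ b ≤ load ω i′ ])
    ≡⟨ total-linear m n 𝟙[ 1 ≤ a ] _ _ ⟩
  𝟙[ 1 ≤ a ] * jointTail n i i′ m (pred a) b + jointTail n i i′ m a b ∎
  where open ≤-Reasoning

jointTail-miss : ∀ n i i′ m a b (b₀ : Fin n) → ¬ toℕ b₀ ≡ i → ¬ toℕ b₀ ≡ i′ →
                 total m n (λ ω → 𝟙[ a ≤ load (b₀ ∷ ω) i ] * 𝟙[ b ≤ load (b₀ ∷ ω) i′ ]) ≡ jointTail n i i′ m a b
jointTail-miss n i i′ m a b b₀ b₀≢i b₀≢i′ =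
  total-cong m n (λ ω → cong₂ (λ x y → 𝟙[ a ≤ x ] * 𝟙[ b ≤ y ]) (load-miss b₀ ω i b₀≢i) (load-miss b₀ ω i′ b₀≢i′))

jointTail-firstBall : ∀ n i i′ m a b → ¬ i ≡ i′ → (b₀ : Fin n) →
  total m n (λ ω → 𝟙[ a ≤ load (b₀ ∷ ω) i ] * 𝟙[ b ≤ load (b₀ ∷ ω) i′ ])
    ≤ 𝟙[ toℕ b₀ ≡ i ] * (𝟙[ 1 ≤ a ] * jointTail n i i′ m (pred a) b)
      + 𝟙[ toℕ b₀ ≡ i′ ] * (𝟙[ 1 ≤ b ] * jointTail n i i′ m a (pred b))
      + jointTail n i i′ m a b
jointTail-firstBall n i i′ m a b i≢i′ b₀ with toℕ b₀ ≟ i | toℕ b₀ ≟ i′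
... | yes b₀≡i | yes b₀≡i′ = ⊥-elim (i≢i′ (trans (sym b₀≡i) b₀≡i′))
... | yes b₀≡i | no b₀≢i′ rewrite 𝟙≡-yes b₀≡i | 𝟙≡-no (toℕ b₀) i′ b₀≢i′ =
  ≤-trans (jointTail-hit n i i′ m a b b₀ b₀≡i b₀≢i′)
          (≤-reflexive (cong (_+ jointTail n i i′ m a b) (sym (trans (+-identityʳ _) (+-identityʳ _)))))
... | no b₀≢i | yes b₀≡i′ rewrite 𝟙≡-no (toℕ b₀) i b₀≢i | 𝟙≡-yes b₀≡i′ = begin
  total m n (λ ω → 𝟙[ a ≤ load (b₀ ∷ ω) i ] * 𝟙[ b ≤ load (b₀ ∷ ω) i′ ])
    ≡⟨ total-cong m n (λ ω → *-comm 𝟙[ a ≤ load (b₀ ∷ ω) i ] _) ⟩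
  total m n (λ ω → 𝟙[ b ≤ load (b₀ ∷ ω) i′ ] * 𝟙[ a ≤ load (b₀ ∷ ω) i ])
    ≤⟨ jointTail-hit n i′ i m b a b₀ b₀≡i′ b₀≢i ⟩
  𝟙[ 1 ≤ b ] * jointTail n i′ i m (pred b) a + jointTail n i′ i m b a
    ≡⟨ cong₂ (λ x y → 𝟙[ 1 ≤ b ] * x + y) (jointTail-swap n i′ i m (pred b) a) (jointTail-swap n i′ i m b a) ⟩
  𝟙[ 1 ≤ b ] * jointTail n i i′ m a (pred b) + jointTail n i i′ m a b
    ≡⟨ cong (_+ jointTail n i i′ m a b) (+-identityʳ _) ⟨
  𝟙[ 1 ≤ b ] * jointTail n i i′ m a (pred b) + 0 + jointTail n i i′ m a b ∎
  where open ≤-Reasoning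
... | no b₀≢i | no b₀≢i′ rewrite 𝟙≡-no (toℕ b₀) i b₀≢i | 𝟙≡-no (toℕ b₀) i′ b₀≢i′ =
  ≤-reflexive (jointTail-miss n i i′ m a b b₀ b₀≢i b₀≢i′)

jointTail-step : ∀ n i i′ m a b → ¬ i ≡ i′ →
  jointTail n i i′ (suc m) a b
    ≤ 𝟙[ 1 ≤ a ] * jointTail n i i′ m (pred a) b + 𝟙[ 1 ≤ b ] * jointTail n i i′ m a (pred b)
      + n * jointTail n i i′ m a b
jointTail-step n i i′ m a b i≢i′ = begin
  jointTail n i i′ (suc m) a b
    ≡⟨ total-step m n _ ⟩
  sum (tabulate (λ b₀ → total m n (λ ω → 𝟙[ a ≤ load (b₀ ∷ ω) i ] * 𝟙[ b ≤ load (b₀ ∷ ω) i′ ])))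
    ≤⟨ sumFin-≤ n _ (λ x → 𝟙[ x ≡ i ] * A + 𝟙[ x ≡ i′ ] * B + C) (jointTail-firstBall n i i′ m a b i≢i′) ⟩
  ∑[ x < n ] (𝟙[ x ≡ i ] * A + 𝟙[ x ≡ i′ ] * B + C)
    ≡⟨ trans (sumBelow-+ n _ _) (cong (_+ ∑[ x < n ] C) (sumBelow-+ n _ _)) ⟩
  ∑[ x < n ] (𝟙[ x ≡ i ] * A) + ∑[ x < n ] (𝟙[ x ≡ i′ ] * B) + ∑[ x < n ] C
    ≤⟨ +-mono-≤ (+-mono-≤ (sumBelow-𝟙≡-* n i A) (sumBelow-𝟙≡-* n i′ B)) (≤-reflexive (sumBelow-const n C)) ⟩
  A + B + n * C ∎
  where
  open ≤-Reasoning
  A = 𝟙[ 1 ≤ a ] * jointTail n i i′ m (pred a) b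
  B = 𝟙[ 1 ≤ b ] * jointTail n i i′ m a (pred b)
  C = jointTail n i i′ m a b

JointTailBound : (n i i′ m : ℕ) → Set
JointTailBound n i i′ m = ∀ a b → jointTail n i i′ m a b * n ^ (a + b) ≤ (m C a) * (m C b) * n ^ m

jointTail-lowerˡ : ∀ n i i′ m → JointTailBound n i i′ m → ∀ a b →
                   𝟙[ 1 ≤ a ] * jointTail n i i′ m (pred a) b * n ^ (a + b) ≤ n * (𝟙[ 1 ≤ a ] * (m C pred a) * (m C b) * n ^ m)
jointTail-lowerˡ n i i′ m bound zero    b = z≤n
jointTail-lowerˡ n i i′ m bound (suc a) b = begin
  1 * J a b * (n * n ^ (a + b))       ≡⟨ regroup (J a b) (n ^ (a + b)) n ⟩
  n * (J a b * n ^ (a + b))           ≤⟨ *-monoʳ-≤ n (bound a b) ⟩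
  n * ((m C a) * (m C b) * n ^ m)     ≡⟨ cong (λ x → n * (x * (m C b) * n ^ m)) (*-identityˡ (m C a)) ⟨
  n * (1 * (m C a) * (m C b) * n ^ m) ∎
  where
  open ≤-Reasoning
  J = jointTail n i i′ m
  regroup : ∀ F P N → 1 * F * (N * P) ≡ N * (F * P)
  regroup = solve-∀

jointTail-lowerʳ : ∀ n i i′ m → JointTailBound n i i′ m → ∀ a b →
                   𝟙[ 1 ≤ b ] * jointTail n i i′ m a (pred b) * n ^ (a + b) ≤ n * ((m C a) * (𝟙[ 1 ≤ b ] * (m C pred b)) * n ^ m)
jointTail-lowerʳ n i i′ m bound a zero    = z≤n
jointTail-lowerʳ n i i′ m bound a (suc b) = begin
  1 * J a b * n ^ (a + suc b)           ≡⟨ cong (λ e → 1 * J a b * n ^ e) (+-suc a b) ⟩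
  1 * J a b * (n * n ^ (a + b))         ≡⟨ regroup (J a b) (n ^ (a + b)) n ⟩
  n * (J a b * n ^ (a + b))             ≤⟨ *-monoʳ-≤ n (bound a b) ⟩
  n * ((m C a) * (m C b) * n ^ m)       ≡⟨ cong (λ x → n * ((m C a) * x * n ^ m)) (*-identityˡ (m C b)) ⟨
  n * ((m C a) * (1 * (m C b)) * n ^ m) ∎
  where
  open ≤-Reasoning
  J = jointTail n i i′ m
  regroup : ∀ F P N → 1 * F * (N * P) ≡ N * (F * P)
  regroup = solve-∀

-- By induction on m, using jointTail-step and Pascal's rule.
jointTail-bound : ∀ n i i′ → ¬ i ≡ i′ → ∀ m → JointTailBound n i i′ m
jointTail-bound n i i′ i≢i′ zero a b rewrite load-empty n i | load-empty n i′ = base a b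
  where
  base : ∀ a b → (𝟙[ a ≤ 0 ] * 𝟙[ b ≤ 0 ] + 0) * n ^ (a + b) ≤ (0 C a) * (0 C b) * 1
  base zero    zero    = ≤-refl
  base zero    (suc b) = z≤n
  base (suc a) b       = z≤n
jointTail-bound n i i′ i≢i′ (suc m) a b = begin
  J (suc m) a b * n ^ (a + b)
    ≤⟨ *-monoˡ-≤ (n ^ (a + b)) (jointTail-step n i i′ m a b i≢i′) ⟩
  (𝟙[ 1 ≤ a ] * J m (pred a) b + 𝟙[ 1 ≤ b ] * J m a (pred b) + n * J m a b) * n ^ (a + b)
    ≡⟨ distrib3 (𝟙[ 1 ≤ a ] * J m (pred a) b) (𝟙[ 1 ≤ b ] * J m a (pred b)) (n * J m a b) (n ^ (a + b)) ⟩
  𝟙[ 1 ≤ a ] * J m (pred a) b * n ^ (a + b) + 𝟙[ 1 ≤ b ] * J m a (pred b) * n ^ (a + b) + n * J m a b * n ^ (a + b)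
    ≤⟨ +-mono-≤ (+-mono-≤ (jointTail-lowerˡ n i i′ m IH a b) (jointTail-lowerʳ n i i′ m IH a b))
                (≤-trans (≤-reflexive (*-assoc n _ _)) (*-monoʳ-≤ n (IH a b))) ⟩
  n * (Ca′ * Cb * n ^ m) + n * (Ca * Cb′ * n ^ m) + n * (Ca * Cb * n ^ m)
    ≤⟨ m≤m+n _ _ ⟩
  n * (Ca′ * Cb * n ^ m) + n * (Ca * Cb′ * n ^ m) + n * (Ca * Cb * n ^ m) + n * (Ca′ * Cb′ * n ^ m)
    ≡⟨ expand n (n ^ m) Ca′ Ca Cb′ Cb ⟨
  (Ca + Ca′) * (Cb + Cb′) * (n * n ^ m)
    ≡⟨ cong₂ (λ x y → x * y * (n * n ^ m)) (C-pascal m a) (C-pascal m b) ⟨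
  (suc m C a) * (suc m C b) * n ^ suc m ∎
  where
  open ≤-Reasoning
  J = jointTail n i i′
  IH : JointTailBound n i i′ m
  IH = jointTail-bound n i i′ i≢i′ m
  Ca  = m C a
  Cb  = m C b
  Ca′ = 𝟙[ 1 ≤ a ] * (m C pred a)
  Cb′ = 𝟙[ 1 ≤ b ] * (m C pred b)
  distrib3 : ∀ x y z w → (x + y + z) * w ≡ x * w + y * w + z * w
  distrib3 = solve-∀
  expand : ∀ N M pa ba pb bb → (ba + pa) * (bb + pb) * (N * M)
           ≡ N * (pa * bb * M) + N * (ba * pb * M) + N * (ba * bb * M) + N * (pa * pb * M)
  expand = solve-∀

pointMass : (n i m a : ℕ) → ℕ
pointMass n i m a = total m n (λ ω → 𝟙[ a ≡ load ω i ])

pointMass-step : ∀ z i m a → i < suc z →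
                 𝟙[ 1 ≤ a ] * pointMass (suc z) i m (pred a) + z * pointMass (suc z) i m a
                   ≤ pointMass (suc z) i (suc m) a
pointMass-step z i m a i<n = begin
  A + z * B
    ≤⟨ sumBelow-≥-split z i i<n A B firstBallIn hit miss ⟩
  sumBelow (suc z) firstBallIn
    ≤⟨ sumFin-≥ (suc z) _ firstBallIn (λ b₀ → ≤-reflexive (total-cong m n (λ ω → cong 𝟙[ a ≡_] (sym (load-cons b₀ ω i))))) ⟩
  sum (tabulate (λ b₀ → total m n (λ ω → 𝟙[ a ≡ load (b₀ ∷ ω) i ])))
    ≡⟨ total-step m n _ ⟨
  pointMass n i (suc m) a ∎
  where
  open ≤-Reasoning
  n = suc z
  A = 𝟙[ 1 ≤ a ] * pointMass n i m (pred a)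
  B = pointMass n i m a
  firstBallIn : ℕ → ℕ
  firstBallIn x = total m n (λ ω → 𝟙[ a ≡ 𝟙[ x ≡ i ] + load ω i ])
  hit : A ≤ firstBallIn i
  hit = ≤-reflexive (sym (trans
    (total-cong m n (λ ω → trans (cong (λ e → 𝟙[ a ≡ e + load ω i ]) (𝟙≡-refl i)) (𝟙≡-suc a (load ω i))))
    (total-scale m n 𝟙[ 1 ≤ a ] _)))
  miss : ∀ x → ¬ x ≡ i → B ≤ firstBallIn x
  miss x x≢i = ≤-reflexive (sym (total-cong m n (λ ω → cong (λ e → 𝟙[ a ≡ e + load ω i ]) (𝟙≡-no x i x≢i))))

pointMass-bound : ∀ z i → i < suc z → ∀ m a → (m C a) * z ^ m ≤ pointMass (suc z) i m a * z ^ a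
pointMass-bound z i i<n zero a rewrite load-empty (suc z) i = base a
  where
  base : ∀ a → (0 C a) * 1 ≤ (𝟙[ a ≡ 0 ] + 0) * z ^ a
  base zero    = ≤-refl
  base (suc a) = z≤n
pointMass-bound z i i<n (suc m) a = begin
  (suc m C a) * z ^ suc m
    ≡⟨ cong (_* z ^ suc m) (C-pascal m a) ⟩
  ((m C a) + 𝟙[ 1 ≤ a ] * (m C pred a)) * (z * z ^ m)
    ≡⟨ split (m C a) (𝟙[ 1 ≤ a ] * (m C pred a)) (z ^ m) z ⟩
  z * ((m C a) * z ^ m) + z * (𝟙[ 1 ≤ a ] * (m C pred a) * z ^ m)
    ≤⟨ +-mono-≤ (*-monoʳ-≤ z (IH a)) (shifted a) ⟩
  z * (H m a * z ^ a) + 𝟙[ 1 ≤ a ] * H m (pred a) * z ^ a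
    ≡⟨ collect (H m a) (𝟙[ 1 ≤ a ] * H m (pred a)) z (z ^ a) ⟩
  (𝟙[ 1 ≤ a ] * H m (pred a) + z * H m a) * z ^ a
    ≤⟨ *-monoˡ-≤ (z ^ a) (pointMass-step z i m a i<n) ⟩
  H (suc m) a * z ^ a ∎
  where
  open ≤-Reasoning
  H = pointMass (suc z) i
  IH : ∀ a → (m C a) * z ^ m ≤ H m a * z ^ a
  IH = pointMass-bound z i i<n m
  split : ∀ b p x z → (b + p) * (z * x) ≡ z * (b * x) + z * (p * x)
  split = solve-∀
  collect : ∀ h p z y → z * (h * y) + p * y ≡ (p + z * h) * y
  collect = solve-∀
  regroup : ∀ h z y → z * (h * y) ≡ 1 * h * (z * y)
  regroup = solve-∀
  shifted : ∀ a → z * (𝟙[ 1 ≤ a ] * (m C pred a) * z ^ m) ≤ 𝟙[ 1 ≤ a ] * H m (pred a) * z ^ a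
  shifted zero    = ≤-reflexive (*-zeroʳ z)
  shifted (suc a) = begin
    z * (1 * (m C a) * z ^ m) ≡⟨ cong (λ x → z * (x * z ^ m)) (*-identityˡ (m C a)) ⟩
    z * ((m C a) * z ^ m)     ≤⟨ *-monoʳ-≤ z (IH a) ⟩
    z * (H m a * z ^ a)       ≡⟨ regroup (H m a) z (z ^ a) ⟩
    1 * H m a * (z * z ^ a)   ∎

power-increment : ∀ z x h → (z + x) ^ h * (z + x) ≤ z ^ h * (z + x) + h * x * (z + x) ^ h
power-increment z x zero    = m≤m+n _ _
power-increment z x (suc h) = begin
  (z + x) * (z + x) ^ h * (z + x)
    ≡⟨ *-assoc (z + x) _ _ ⟩
  (z + x) * ((z + x) ^ h * (z + x))
    ≤⟨ *-monoʳ-≤ (z + x) (power-increment z x h) ⟩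
  (z + x) * (z ^ h * (z + x) + h * x * (z + x) ^ h)
    ≡⟨ expand z x (z ^ h) (h * x * (z + x) ^ h) ⟩
  z * z ^ h * (z + x) + x * (z ^ h * (z + x)) + (z + x) * (h * x * (z + x) ^ h)
    ≤⟨ +-monoˡ-≤ _ (+-monoʳ-≤ (z * z ^ h * (z + x)) (*-monoʳ-≤ x (*-monoˡ-≤ (z + x) (^-monoˡ-≤ h (m≤m+n z x))))) ⟩
  z * z ^ h * (z + x) + x * ((z + x) ^ h * (z + x)) + (z + x) * (h * x * (z + x) ^ h)
    ≡⟨ collect z x (z ^ h) ((z + x) ^ h) h ⟩
  z * z ^ h * (z + x) + suc h * x * ((z + x) * (z + x) ^ h) ∎
  where
  open ≤-Reasoning
  expand : ∀ z x Z e → (z + x) * (Z * (z + x) + e) ≡ z * Z * (z + x) + x * (Z * (z + x)) + (z + x) * e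
  expand = solve-∀
  collect : ∀ z x Z Y h → z * Z * (z + x) + x * (Y * (z + x)) + (z + x) * (h * x * Y)
                          ≡ z * Z * (z + x) + suc h * x * ((z + x) * Y)
  collect = solve-∀

power-doubling : ∀ z x h → 1 ≤ z + x → 2 * h * x ≤ z + x → (z + x) ^ h ≤ 2 * z ^ h
power-doubling z x h 1≤y 2hx≤y =
  *-cancelʳ-≤ A (2 * B) y {{>-nonZero 1≤y}} (+-cancelʳ-≤ (A * y) (A * y) (2 * B * y) twice)
  where
  y = z + x
  A = (z + x) ^ h
  B = z ^ h
  rearrange : ∀ A y B e → 2 * (B * y + e * A) ≡ 2 * B * y + 2 * e * A
  rearrange = solve-∀
  twice : A * y + A * y ≤ 2 * B * y + A * y
  twice = begin
    A * y + A * y               ≡⟨ cong (A * y +_) (+-identityʳ (A * y)) ⟨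
    2 * (A * y)                 ≤⟨ *-monoʳ-≤ 2 (power-increment z x h) ⟩
    2 * (B * y + h * x * A)     ≡⟨ rearrange A y B (h * x) ⟩
    2 * B * y + 2 * (h * x) * A ≤⟨ +-monoʳ-≤ (2 * B * y) (*-monoˡ-≤ A (≤-trans (≤-reflexive (sym (*-assoc 2 h x))) 2hx≤y)) ⟩
    2 * B * y + y * A           ≡⟨ cong (2 * B * y +_) (*-comm y A) ⟩
    2 * B * y + A * y           ∎
    where open ≤-Reasoning

-- n ≤ 2n², so that 2t² ≤ n forces t ≤ n.
n≤2*n*n : ∀ n → n ≤ 2 * n * n
n≤2*n*n zero    = z≤n
n≤2*n*n (suc n) = ≤-trans (m≤m*n (suc n) (2 * suc n)) (≤-reflexive (*-comm (suc n) (2 * suc n)))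

falling-power : ∀ n t → 1 ≤ n → 2 * t * t ≤ n → n ^ t ≤ 2 * (n ∸ t) ^ t
falling-power n t 1≤n 2tt≤n =
  subst (λ y → y ^ t ≤ 2 * (n ∸ t) ^ t) n∸t+t≡n
        (power-doubling (n ∸ t) t t (subst (1 ≤_) (sym n∸t+t≡n) 1≤n) (subst (2 * t * t ≤_) (sym n∸t+t≡n) 2tt≤n))
  where
  n∸t+t≡n : n ∸ t + t ≡ n
  n∸t+t≡n = m∸n+n≡m (≤-trans (n≤2*n*n t) 2tt≤n)

halves : ∀ n → Σ ℕ λ h → Σ ℕ λ r → (r ≤ 1) × (n ≡ h + h + r)
halves zero          = 0 , 0 , z≤n , refl
halves (suc zero)    = 0 , 1 , s≤s z≤n , refl
halves (suc (suc n)) with halves n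
... | h , r , r≤1 , n≡2h+r = suc h , r , r≤1 , cong suc (trans (cong suc n≡2h+r) (cong (_+ r) (sym (+-suc h h))))

-- (1 + 1/z)^(z+1) ≤ 8: apply power-doubling to each half of the exponent.
succ-power : ∀ z → 1 ≤ z → suc z ^ suc z ≤ 8 * z ^ suc z
succ-power z 1≤z with halves (suc z)
... | h , r , r≤1 , z+1≡2h+r = begin
  suc z ^ suc z                         ≡⟨ cong (suc z ^_) z+1≡2h+r ⟩
  suc z ^ (h + h + r)                   ≡⟨ split (suc z) ⟩
  suc z ^ h * suc z ^ h * suc z ^ r     ≤⟨ *-mono-≤ (*-mono-≤ half half) (remainder r r≤1) ⟩
  2 * z ^ h * (2 * z ^ h) * (2 * z ^ r) ≡⟨ eight (z ^ h) (z ^ r) ⟩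
  8 * (z ^ h * z ^ h * z ^ r)           ≡⟨ cong (8 *_) (split z) ⟨
  8 * z ^ (h + h + r)                   ≡⟨ cong (λ e → 8 * z ^ e) z+1≡2h+r ⟨
  8 * z ^ suc z                         ∎
  where
  open ≤-Reasoning
  split : ∀ y → y ^ (h + h + r) ≡ y ^ h * y ^ h * y ^ r
  split y = trans (^-distribˡ-+-* y (h + h) r) (cong (_* y ^ r) (^-distribˡ-+-* y h h))
  eight : ∀ a b → 2 * a * (2 * a) * (2 * b) ≡ 8 * (a * a * b)
  eight = solve-∀
  double : ∀ h → 2 * h * 1 ≡ h + h
  double = solve-∀
  half : suc z ^ h ≤ 2 * z ^ h
  half = subst (λ y → y ^ h ≤ 2 * z ^ h) (+-comm z 1) (power-doubling z 1 h (m≤n+m 1 z) (begin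
    2 * h * 1 ≡⟨ double h ⟩
    h + h     ≤⟨ m≤m+n (h + h) r ⟩
    h + h + r ≡⟨ z+1≡2h+r ⟨
    suc z     ≡⟨ +-comm 1 z ⟩
    z + 1     ∎))
  remainder : ∀ r → r ≤ 1 → suc z ^ r ≤ 2 * z ^ r
  remainder zero             _         = s≤s z≤n
  remainder (suc zero)       _         = begin
    suc z * 1     ≡⟨ *-identityʳ (suc z) ⟩
    1 + z         ≤⟨ +-monoˡ-≤ z 1≤z ⟩
    z + z         ≡⟨ double z ⟨
    2 * z * 1     ≡⟨ *-assoc 2 z 1 ⟩
    2 * (z * 1)   ∎
  remainder (suc (suc r)) (s≤s ())

square≤pow : ∀ x → 7 ≤ x → 2 * x * x ≤ 2 ^ x
square≤pow x 7≤x = subst (λ y → 2 * y * y ≤ 2 ^ y) (m+[n∸m]≡n 7≤x) (from7 (x ∸ 7))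
  where
  from7 : ∀ d → 2 * (7 + d) * (7 + d) ≤ 2 ^ (7 + d)
  from7 zero    = ≤ᵇ⇒≤ 98 128 tt
  from7 (suc d) = begin
    2 * (8 + d) * (8 + d)                     ≡⟨ next d ⟩
    2 * (7 + d) * (7 + d) + (4 * (7 + d) + 2) ≤⟨ +-mono-≤ (from7 d) (≤-trans (m≤m+n _ _) (≤-trans (≤-reflexive (sym (excess d))) (from7 d))) ⟩
    2 ^ (7 + d) + 2 ^ (7 + d)                 ≡⟨ cong (2 ^ (7 + d) +_) (+-identityʳ _) ⟨
    2 ^ (8 + d)                               ∎
    where
    open ≤-Reasoning
    next : ∀ d → 2 * (8 + d) * (8 + d) ≡ 2 * (7 + d) * (7 + d) + (4 * (7 + d) + 2)
    next = solve-∀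
    excess : ∀ d → 2 * (7 + d) * (7 + d) ≡ 4 * (7 + d) + 2 + (68 + 24 * d + 2 * d * d)
    excess = solve-∀

factorial≤power : ∀ t → t ! ≤ t ^ t
factorial≤power t = ≤-trans (≤-reflexive (sym (nP′n≡n! t))) (P′-upper t t)

log₂-bounds : ∀ m (rec : Acc _<_ m) → 1 ≤ m → (2 ^ ⌊log2⌋ m rec ≤ m) × (m < 2 ^ suc (⌊log2⌋ m rec))
log₂-bounds (suc zero)    _        _ = s≤s z≤n , s≤s (s≤s z≤n)
log₂-bounds (suc (suc k)) (acc rs) _ with log₂-bounds (suc ⌊ k /2⌋) (rs _) (s≤s z≤n)
... | lower , upper = lower′ , upper′
  where
  p = 2 ^ ⌊log2⌋ (suc ⌊ k /2⌋) (rs _)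
  twoHalves : ∀ h → 2 * suc h ≡ suc (suc (h + h))
  twoHalves = solve-∀
  twoHalves′ : ∀ h → 2 * suc (suc h) ≡ suc (suc (suc (suc (h + h))))
  twoHalves′ = solve-∀
  lower′ : 2 * p ≤ suc (suc k)
  lower′ = ≤-trans (*-monoʳ-≤ 2 lower) (≤-trans (≤-reflexive (twoHalves ⌊ k /2⌋))
             (s≤s (s≤s (≤-trans (+-monoʳ-≤ ⌊ k /2⌋ (⌊n/2⌋≤⌈n/2⌉ k)) (≤-reflexive (⌊n/2⌋+⌈n/2⌉≡n k))))))
  k≤1+2⌊k/2⌋ : ∀ k → k ≤ suc (⌊ k /2⌋ + ⌊ k /2⌋)
  k≤1+2⌊k/2⌋ zero          = z≤n
  k≤1+2⌊k/2⌋ (suc zero)    = s≤s z≤n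
  k≤1+2⌊k/2⌋ (suc (suc k)) = s≤s (≤-trans (s≤s (k≤1+2⌊k/2⌋ k)) (≤-reflexive (cong suc (sym (+-suc ⌊ k /2⌋ ⌊ k /2⌋)))))
  upper′ : suc (suc (suc k)) ≤ 2 * (2 * p)
  upper′ = ≤-trans (s≤s (s≤s (s≤s (k≤1+2⌊k/2⌋ k)))) (≤-trans (≤-reflexive (sym (twoHalves′ ⌊ k /2⌋))) (*-monoʳ-≤ 2 upper))

log₂-lower : ∀ m → 1 ≤ m → 2 ^ ⌊log₂ m ⌋ ≤ m
log₂-lower m 1≤m = proj₁ (log₂-bounds m (<-wellFounded m) 1≤m)

log₂-upper : ∀ m → 1 ≤ m → m < 2 ^ suc ⌊log₂ m ⌋
log₂-upper m 1≤m = proj₂ (log₂-bounds m (<-wellFounded m) 1≤m)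

-- ⌊log₂ m⌋ ≥ a as soon as 2^a ≤ m.  (Argued via log₂-upper rather than by evaluating
-- ⌊log₂ (2^a)⌋, which is costly for large numerals a.)
log₂-≥ : ∀ a m → 2 ^ a ≤ m → a ≤ ⌊log₂ m ⌋
log₂-≥ a m 2^a≤m with a ≤? ⌊log₂ m ⌋
... | yes a≤ℓ = a≤ℓ
... | no  a≰ℓ = ⊥-elim (<-irrefl refl (<-≤-trans (log₂-upper m 1≤m) (≤-trans (^-monoʳ-≤ 2 (≰⇒> a≰ℓ)) 2^a≤m)))
  where
  1≤m : 1 ≤ m
  1≤m = ≤-trans (m^n>0 2 a) 2^a≤m

countAtLeast : ℕ → List ℕ → ℕ
countAtLeast t xs = sumOver xs (λ x → 𝟙[ t ≤ x ])

countAtLeast-↭ : ∀ t {xs ys} → xs ↭ ys → countAtLeast t xs ≡ countAtLeast t ys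
countAtLeast-↭ t xs↭ys = sum-↭ (↭-map⁺ (λ x → 𝟙[ t ≤ x ]) xs↭ys)

countAtLeast-prefix : ∀ {n} (v : Vec ℕ n) N t → 1 ≤ t → ∑[ j < N ] 𝟙[ t ≤ entry v j ] ≤ countAtLeast t (toList v)
countAtLeast-prefix []      N       (suc t) _   = ≤-reflexive (trans (sumBelow-const N 0) (*-zeroʳ N))
countAtLeast-prefix (x ∷ v) zero    t       _   = z≤n
countAtLeast-prefix (x ∷ v) (suc N) t       1≤t = +-monoʳ-≤ 𝟙[ t ≤ x ] (countAtLeast-prefix v N t 1≤t)

sum-take-++ : ∀ k (xs ys : List ℕ) → sum (take k xs) ≤ sum (take k (xs ++ ys))
sum-take-++ zero    xs       ys = z≤n
sum-take-++ (suc k) []       ys = z≤n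
sum-take-++ (suc k) (x ∷ xs) ys = +-monoʳ-≤ x (sum-take-++ k xs ys)

sum-take-≥ : ∀ t k zs → All (t ≤_) zs → t * (k ⊓ countAtLeast t zs) ≤ sum (take k zs)
sum-take-≥ t zero    zs       _          = ≤-reflexive (*-zeroʳ t)
sum-take-≥ t (suc k) []       _          = ≤-reflexive (*-zeroʳ t)
sum-take-≥ t (suc k) (z ∷ zs) (t≤z ∷ ps) rewrite 𝟙≤-yes t z t≤z =
  ≤-trans (≤-reflexive (*-suc t (k ⊓ countAtLeast t zs))) (+-mono-≤ t≤z (sum-take-≥ t k zs ps))

All-reverse : ∀ {Q : ℕ → Set} (xs : List ℕ) → All Q xs → All Q (reverse xs)
All-reverse []       []       = []
All-reverse (x ∷ xs) (p ∷ ps) = subst (All _) (sym (unfold-reverse x xs)) (++⁺ (All-reverse xs ps) (p ∷ []))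

sorted-top-≥ : ∀ t k ys → Linked _≤_ ys → t * (k ⊓ countAtLeast t ys) ≤ sum (take k (reverse ys))
sorted-top-≥ t k []       _  = ≤-trans (≤-reflexive (trans (cong (t *_) (⊓-zeroʳ k)) (*-zeroʳ t))) z≤n
sorted-top-≥ t k (y ∷ ys) ys↗ with t ≤? y
... | yes t≤y = ≤-trans (≤-reflexive (cong (λ c → t * (k ⊓ c)) (sym (countAtLeast-↭ t (↭-reverse (y ∷ ys))))))
                        (sum-take-≥ t k (reverse (y ∷ ys)) (All-reverse (y ∷ ys) (Linked⇒All ≤-trans t≤y ys↗)))
... | no  t≰y = begin
  t * (k ⊓ (𝟙[ t ≤ y ] + countAtLeast t ys)) ≡⟨ cong (λ c → t * (k ⊓ (c + countAtLeast t ys))) (𝟙≤-no t y t≰y) ⟩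
  t * (k ⊓ countAtLeast t ys)                ≤⟨ sorted-top-≥ t k ys (Linked.tail ys↗) ⟩
  sum (take k (reverse ys))                  ≤⟨ sum-take-++ k (reverse ys) (y ∷ []) ⟩
  sum (take k (reverse ys ++ y ∷ []))        ≡⟨ cong (λ zs → sum (take k zs)) (unfold-reverse y ys) ⟨
  sum (take k (reverse (y ∷ ys)))            ∎
  where open ≤-Reasoning

heavyBins : ∀ {m n} → ℕ → ℕ → Vec (Fin n) m → ℕ
heavyBins t N ω = ∑[ j < N ] 𝟙[ t ≤ load ω j ]

topSum-≥ : ∀ {m n} t k N (ω : Vec (Fin n) m) → 1 ≤ t → t * (k ⊓ heavyBins t N ω) ≤ topSum k ω
topSum-≥ t k N ω 1≤t = begin
  t * (k ⊓ heavyBins t N ω)             ≤⟨ *-monoʳ-≤ t (⊓-monoʳ-≤ k (countAtLeast-prefix (loads ω) N t 1≤t)) ⟩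
  t * (k ⊓ countAtLeast t xs)            ≡⟨ cong (λ c → t * (k ⊓ c)) (countAtLeast-↭ t (sort-↭ xs)) ⟨
  t * (k ⊓ countAtLeast t (sort xs))     ≤⟨ sorted-top-≥ t k (sort xs) (sort-↗ xs) ⟩
  topSum k ω                             ∎
  where
  open ≤-Reasoning
  xs = toList (loads ω)

n≤n*n : ∀ n → n ≤ n * n
n≤n*n zero    = z≤n
n≤n*n (suc n) = m≤m*n (suc n) (suc n)

min-square : ∀ k X → 2 * k * X + X ≤ 2 * k * (k ⊓ X) + X * X
min-square k X with X ≤? k
... | yes X≤k rewrite m≥n⇒m⊓n≡n X≤k = +-monoʳ-≤ (2 * k * X) (n≤n*n X)
... | no  X≰k = subst (λ X → 2 * k * X + X ≤ 2 * k * (k ⊓ X) + X * X) (m+[n∸m]≡n k≤X) (excess (X ∸ k))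
  where
  k≤X : k ≤ X
  k≤X = <⇒≤ (≰⇒> X≰k)
  lhs : ∀ k e → 2 * k * (k + e) + (k + e) ≡ (2 * k * k + 2 * k * e) + (k + e)
  lhs = solve-∀
  rhs : ∀ k e → 2 * k * k + (k + e) * (k + e) ≡ (2 * k * k + 2 * k * e) + (k * k + e * e)
  rhs = solve-∀
  excess : ∀ e → 2 * k * (k + e) + (k + e) ≤ 2 * k * (k ⊓ (k + e)) + (k + e) * (k + e)
  excess e rewrite m≤n⇒m⊓n≡m (m≤m+n k e) | lhs k e | rhs k e =
    +-monoʳ-≤ (2 * k * k + 2 * k * e) (+-mono-≤ (n≤n*n k) (n≤n*n e))

offDiagonal : ℕ → (ℕ → ℕ) → ℕ
offDiagonal N f = ∑[ j < N ] ∑[ j′ < N ] ((1 ∸ 𝟙[ j′ ≡ j ]) * (f j * f j′))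

square-≤ : ∀ N (f : ℕ → ℕ) → (∀ j → f j ≤ 1) → sumBelow N f * sumBelow N f ≤ sumBelow N f + offDiagonal N f
square-≤ N f f≤1 = begin
  S * S
    ≡⟨ sumBelow-*ˡ N S f ⟨
  ∑[ j < N ] (S * f j)
    ≡⟨ sumBelow-cong N (λ j → trans (*-comm S (f j)) (sym (sumBelow-*ˡ N (f j) f))) ⟩
  ∑[ j < N ] ∑[ j′ < N ] (f j * f j′)
    ≤⟨ sumBelow-mono N (λ j → sumBelow-mono N (diagonal j)) ⟩
  ∑[ j < N ] ∑[ j′ < N ] (𝟙[ j′ ≡ j ] * f j + (1 ∸ 𝟙[ j′ ≡ j ]) * (f j * f j′))
    ≡⟨ sumBelow-cong N (λ j → sumBelow-+ N _ _) ⟩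
  ∑[ j < N ] (∑[ j′ < N ] (𝟙[ j′ ≡ j ] * f j) + ∑[ j′ < N ] ((1 ∸ 𝟙[ j′ ≡ j ]) * (f j * f j′)))
    ≤⟨ sumBelow-mono N (λ j → +-monoˡ-≤ _ (sumBelow-𝟙≡-* N j (f j))) ⟩
  ∑[ j < N ] (f j + ∑[ j′ < N ] ((1 ∸ 𝟙[ j′ ≡ j ]) * (f j * f j′)))
    ≡⟨ sumBelow-+ N _ _ ⟩
  S + offDiagonal N f ∎
  where
  open ≤-Reasoning
  S = sumBelow N f
  diagonal : ∀ j j′ → f j * f j′ ≤ 𝟙[ j′ ≡ j ] * f j + (1 ∸ 𝟙[ j′ ≡ j ]) * (f j * f j′)
  diagonal j j′ with j′ ≟ j
  ... | yes j′≡j rewrite 𝟙≡-yes j′≡j =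
    ≤-trans (*-monoʳ-≤ (f j) (f≤1 j′)) (≤-reflexive (trans (*-identityʳ (f j)) (sym (trans (+-identityʳ _) (+-identityʳ _)))))
  ... | no  j′≢j rewrite 𝟙≡-no j′ j j′≢j = ≤-reflexive (sym (+-identityʳ _))

second-moment : ∀ k u M S₁ S₂ Sₘ → 1 ≤ k → 1 ≤ u →
                k * u * M ≤ 16 * (16 * u) * S₁ → (16 * u) * (16 * u) * S₂ ≤ (k * u) * (k * u) * M →
                2 * k * S₁ ≤ 2 * k * Sₘ + S₂ → k * M ≤ 512 * Sₘ
second-moment k u M S₁ S₂ Sₘ 1≤k 1≤u first pairs truncation =
  *-cancelˡ-≤ k {{>-nonZero 1≤k}} (≤-trans (≤-reflexive (sym (*-assoc k k M))) kkM≤k512Sₘ)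
  where
  e₁ : ∀ k u M → k * u * M ≡ u * (k * M)
  e₁ = solve-∀
  e₂ : ∀ u S → 16 * (16 * u) * S ≡ u * (256 * S)
  e₂ = solve-∀
  e₃ : ∀ k u X → (k * u) * (k * u) * X ≡ (u * u) * (k * k * X)
  e₃ = solve-∀
  e₄ : ∀ k X → k * k * X + k * k * X ≡ 2 * k * (k * X)
  e₄ = solve-∀
  e₅ : ∀ k S → 2 * k * (256 * S) ≡ 256 * (2 * k * S)
  e₅ = solve-∀
  e₆ : ∀ k S P → 256 * (2 * k * S + P) ≡ k * (512 * S) + 256 * P
  e₆ = solve-∀
  kM≤256S₁ : k * M ≤ 256 * S₁
  kM≤256S₁ = *-cancelˡ-≤ u {{>-nonZero 1≤u}} (≤-trans (≤-reflexive (sym (e₁ k u M))) (≤-trans first (≤-reflexive (e₂ u S₁))))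
  256S₂≤kkM : 256 * S₂ ≤ k * k * M
  256S₂≤kkM = *-cancelˡ-≤ (u * u) {{>-nonZero (*-mono-≤ 1≤u 1≤u)}}
    (≤-trans (≤-reflexive (sym (e₃ 16 u S₂))) (≤-trans pairs (≤-reflexive (e₃ k u M))))
  kkM≤k512Sₘ : k * k * M ≤ k * (512 * Sₘ)
  kkM≤k512Sₘ = +-cancelʳ-≤ (k * k * M) (k * k * M) (k * (512 * Sₘ)) (begin
    k * k * M + k * k * M   ≡⟨ e₄ k M ⟩
    2 * k * (k * M)         ≤⟨ *-monoʳ-≤ (2 * k) kM≤256S₁ ⟩
    2 * k * (256 * S₁)      ≡⟨ e₅ k S₁ ⟩
    256 * (2 * k * S₁)      ≤⟨ *-monoʳ-≤ 256 truncation ⟩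
    256 * (2 * k * Sₘ + S₂) ≡⟨ e₆ k Sₘ S₂ ⟩
    k * (512 * Sₘ) + 256 * S₂ ≤⟨ +-monoʳ-≤ (k * (512 * Sₘ)) 256S₂≤kkM ⟩
    k * (512 * Sₘ) + k * k * M ∎)
    where open ≤-Reasoning

tail-lower : ∀ z t j → 1 ≤ z → 2 * t * t ≤ suc z → j < suc z →
             suc z ^ suc z ≤ 16 * t ! * total (suc z) (suc z) (λ ω → 𝟙[ t ≤ load ω j ])
tail-lower z t j 1≤z 2tt≤n j<n = *-cancelʳ-≤ (n ^ n) _ (z ^ t) {{m^n≢0 z t {{>-nonZero 1≤z}}}} (begin
  n ^ n * z ^ t                          ≤⟨ *-mono-≤ (succ-power z 1≤z) (^-monoˡ-≤ t (n≤1+n z)) ⟩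
  8 * z ^ n * n ^ t                      ≤⟨ *-monoʳ-≤ (8 * z ^ n) (falling-power n t (s≤s z≤n) 2tt≤n) ⟩
  8 * z ^ n * (2 * (n ∸ t) ^ t)          ≡⟨ e₁ (z ^ n) ((n ∸ t) ^ t) ⟩
  16 * (z ^ n * (n ∸ t) ^ t)             ≤⟨ *-monoʳ-≤ 16 (*-monoʳ-≤ (z ^ n) (C*!-lower (≤-trans (n≤2*n*n t) 2tt≤n))) ⟩
  16 * (z ^ n * ((n C t) * t !))         ≡⟨ e₂ (n C t) (t !) (z ^ n) ⟩
  16 * t ! * ((n C t) * z ^ n)           ≤⟨ *-monoʳ-≤ (16 * t !) (pointMass-bound z j j<n n t) ⟩
  16 * t ! * (pointMass n j n t * z ^ t) ≡⟨ *-assoc (16 * t !) _ (z ^ t) ⟨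
  16 * t ! * pointMass n j n t * z ^ t   ≤⟨ *-monoˡ-≤ (z ^ t) (*-monoʳ-≤ (16 * t !) (total-mono n n (λ ω → 𝟙≡≤𝟙≤ t (load ω j)))) ⟩
  16 * t ! * total n n (λ ω → 𝟙[ t ≤ load ω j ]) * z ^ t ∎)
  where
  open ≤-Reasoning
  n = suc z
  e₁ : ∀ a b → 8 * a * (2 * b) ≡ 16 * (a * b)
  e₁ = solve-∀
  e₂ : ∀ c f a → 16 * (a * (c * f)) ≡ 16 * f * (c * a)
  e₂ = solve-∀

pair-upper : ∀ n t j j′ → 1 ≤ n → t ≤ n → ¬ j ≡ j′ → t ! * t ! * jointTail n j j′ n t t ≤ n ^ n
pair-upper n t j j′ 1≤n t≤n j≢j′ = *-cancelʳ-≤ _ (n ^ n) (n ^ (t + t)) {{m^n≢0 n (t + t) {{>-nonZero 1≤n}}}} (begin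
  t ! * t ! * J * n ^ (t + t)                 ≡⟨ *-assoc (t ! * t !) J _ ⟩
  t ! * t ! * (J * n ^ (t + t))               ≤⟨ *-monoʳ-≤ (t ! * t !) (jointTail-bound n j j′ j≢j′ n t t) ⟩
  t ! * t ! * ((n C t) * (n C t) * n ^ n)     ≡⟨ e₁ (n C t) (t !) (n ^ n) ⟩
  (n C t) * t ! * ((n C t) * t !) * n ^ n     ≤⟨ *-monoˡ-≤ (n ^ n) (*-mono-≤ (C*!-upper t≤n) (C*!-upper t≤n)) ⟩
  n ^ t * n ^ t * n ^ n                       ≡⟨ trans (e₂ (n ^ t) (n ^ n)) (cong (n ^ n *_) (sym (^-distribˡ-+-* n t t))) ⟩
  n ^ n * n ^ (t + t)                         ∎)
  where
  open ≤-Reasoning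
  J = jointTail n j j′ n t t
  e₁ : ∀ c f M → f * f * (c * c * M) ≡ c * f * (c * f) * M
  e₁ = solve-∀
  e₂ : ∀ A B → A * A * B ≡ B * (A * A)
  e₂ = solve-∀

first-moment : ∀ z t N → 1 ≤ z → 2 * t * t ≤ suc z → N ≤ suc z →
               N * suc z ^ suc z ≤ 16 * t ! * total (suc z) (suc z) (heavyBins t N)
first-moment z t N 1≤z 2tt≤n N≤n = begin
  N * n ^ n
    ≤⟨ sumBelow-≥ N (n ^ n) _ (λ j j<N → tail-lower z t j 1≤z 2tt≤n (≤-trans j<N N≤n)) ⟩
  ∑[ j < N ] (16 * t ! * total n n (λ ω → 𝟙[ t ≤ load ω j ]))
    ≡⟨ sumBelow-*ˡ N (16 * t !) _ ⟩
  16 * t ! * ∑[ j < N ] (total n n (λ ω → 𝟙[ t ≤ load ω j ]))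
    ≡⟨ cong (16 * t ! *_) (sumOver-sumBelow (outcomes n n) N (λ ω j → 𝟙[ t ≤ load ω j ])) ⟨
  16 * t ! * total n n (heavyBins t N) ∎
  where
  open ≤-Reasoning
  n = suc z

heavyPairs : ∀ {m n} → ℕ → ℕ → Vec (Fin n) m → ℕ
heavyPairs t N ω = offDiagonal N (λ j → 𝟙[ t ≤ load ω j ])

pair-moment : ∀ n t N → 1 ≤ n → t ≤ n → t ! * t ! * total n n (heavyPairs t N) ≤ N * N * n ^ n
pair-moment n t N 1≤n t≤n = begin
  T² * total n n (heavyPairs t N)
    ≡⟨ cong (T² *_) exchange ⟩
  T² * ∑[ j < N ] ∑[ j′ < N ] ((1 ∸ 𝟙[ j′ ≡ j ]) * jointTail n j j′ n t t)
    ≡⟨ trans (sumBelow-cong N (λ j → sumBelow-*ˡ N T² _)) (sumBelow-*ˡ N T² _) ⟨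
  ∑[ j < N ] ∑[ j′ < N ] (T² * ((1 ∸ 𝟙[ j′ ≡ j ]) * jointTail n j j′ n t t))
    ≤⟨ sumBelow-mono N (λ j → sumBelow-mono N (pair j)) ⟩
  ∑[ j < N ] ∑[ j′ < N ] (n ^ n)
    ≡⟨ trans (sumBelow-cong N (λ j → sumBelow-const N (n ^ n))) (sumBelow-const N (N * n ^ n)) ⟩
  N * (N * n ^ n)
    ≡⟨ *-assoc N N (n ^ n) ⟨
  N * N * n ^ n ∎
  where
  open ≤-Reasoning
  T² = t ! * t !
  exchange : total n n (heavyPairs t N) ≡ ∑[ j < N ] ∑[ j′ < N ] ((1 ∸ 𝟙[ j′ ≡ j ]) * jointTail n j j′ n t t)
  exchange = trans (sumOver-sumBelow (outcomes n n) N _) (sumBelow-cong N (λ j →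
             trans (sumOver-sumBelow (outcomes n n) N _) (sumBelow-cong N (λ j′ →
             total-scale n n (1 ∸ 𝟙[ j′ ≡ j ]) _))))
  pair : ∀ j j′ → T² * ((1 ∸ 𝟙[ j′ ≡ j ]) * jointTail n j j′ n t t) ≤ n ^ n
  pair j j′ with j′ ≟ j
  ... | yes j′≡j rewrite 𝟙≡-yes j′≡j = ≤-trans (≤-reflexive (*-zeroʳ T²)) z≤n
  ... | no  j′≢j rewrite 𝟙≡-no j′ j j′≢j =
    ≤-trans (≤-reflexive (cong (T² *_) (+-identityʳ _))) (pair-upper n t j j′ 1≤n t≤n (λ j≡j′ → j′≢j (sym j≡j′)))

truncation : ∀ n t k N → 2 * k * total n n (heavyBins t N)
             ≤ 2 * k * total n n (λ ω → k ⊓ heavyBins t N ω) + total n n (heavyPairs t N)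
truncation n t k N = begin
  2 * k * total n n X
    ≡⟨ total-scale n n (2 * k) X ⟨
  total n n (λ ω → 2 * k * X ω)
    ≤⟨ total-mono n n pointwise ⟩
  total n n (λ ω → 2 * k * (k ⊓ X ω) + heavyPairs t N ω)
    ≡⟨ total-linear n n (2 * k) _ _ ⟩
  2 * k * total n n (λ ω → k ⊓ X ω) + total n n (heavyPairs t N) ∎
  where
  open ≤-Reasoning
  X = heavyBins t N
  regroup : ∀ a b c → a + (b + c) ≡ a + c + b
  regroup = solve-∀
  pointwise : ∀ ω → 2 * k * X ω ≤ 2 * k * (k ⊓ X ω) + heavyPairs t N ω
  pointwise ω = +-cancelʳ-≤ (X ω) (2 * k * X ω) _ (begin
    2 * k * X ω + X ω                                 ≤⟨ min-square k (X ω) ⟩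
    2 * k * (k ⊓ X ω) + X ω * X ω                     ≤⟨ +-monoʳ-≤ (2 * k * (k ⊓ X ω)) (square-≤ N _ (λ j → 𝟙≤-≤1 t (load ω j))) ⟩
    2 * k * (k ⊓ X ω) + (X ω + heavyPairs t N ω)      ≡⟨ regroup (2 * k * (k ⊓ X ω)) (X ω) (heavyPairs t N ω) ⟩
    2 * k * (k ⊓ X ω) + heavyPairs t N ω + X ω        ∎)

topSum-lower : ∀ n t k u → 2 ≤ n → 1 ≤ t → 1 ≤ k → 1 ≤ u → t ! ≡ 16 * u → 2 * t * t ≤ n → k * u ≤ n →
               t * k * n ^ n ≤ 512 * totalTopSum n k
topSum-lower n@(suc z) t k u (s≤s 1≤z) 1≤t 1≤k 1≤u t!≡16u 2tt≤n ku≤n = begin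
  t * k * n ^ n                                      ≡⟨ *-assoc t k (n ^ n) ⟩
  t * (k * n ^ n)                                    ≤⟨ *-monoʳ-≤ t kM≤512Sₘ ⟩
  t * (512 * Sₘ)                                     ≡⟨ swap t Sₘ ⟩
  512 * (t * Sₘ)                                     ≡⟨ cong (512 *_) (total-scale n n t _) ⟨
  512 * total n n (λ ω → t * (k ⊓ heavyBins t N ω))  ≤⟨ *-monoʳ-≤ 512 (total-mono n n (λ ω → topSum-≥ t k N ω 1≤t)) ⟩
  512 * totalTopSum n k                              ∎
  where
  open ≤-Reasoning
  N = k * u
  Sₘ = total n n (λ ω → k ⊓ heavyBins t N ω)
  swap : ∀ a b → a * (512 * b) ≡ 512 * (a * b)
  swap = solve-∀
  kM≤512Sₘ : k * n ^ n ≤ 512 * Sₘ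
  kM≤512Sₘ = second-moment k u (n ^ n) _ _ Sₘ 1≤k 1≤u
    (subst (λ T → N * n ^ n ≤ 16 * T * total n n (heavyBins t N)) t!≡16u (first-moment z t N 1≤z 2tt≤n ku≤n))
    (subst (λ T → T * T * total n n (heavyPairs t N) ≤ N * N * n ^ n) t!≡16u (pair-moment n t N (s≤s z≤n) (≤-trans (n≤2*n*n t) 2tt≤n)))
    (truncation n t k N)

-- 16 divides t! once t ≥ 6, because 6! = 16·45.
sixteen∣t! : ∀ t → 6 ≤ t → Σ ℕ λ u → (t ! ≡ 16 * u) × (1 ≤ u)
sixteen∣t! t 6≤t with m≤n⇒m!∣n! 6≤t
... | divides v t!≡v*720 = 45 * v , trans t!≡v*720 (factor v) , positive v t!≡v*720
  where
  factor : ∀ v → v * 720 ≡ 16 * (45 * v)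
  factor = solve-∀
  positive : ∀ v → t ! ≡ v * 720 → 1 ≤ 45 * v
  positive zero    t!≡0 = ⊥-elim (1+n≰n (≤-trans (1≤n! t) (≤-reflexive t!≡0)))
  positive (suc v) _    = s≤s z≤n

quotient-choice : ∀ ℓ ℓ₂ → 7 ≤ ℓ₂ → 2 ^ ℓ₂ ≤ ℓ → ℓ < 2 ^ suc ℓ₂ →
                  Σ ℕ λ t → (6 ≤ t) × (t ≤ ℓ) × (t ^ t ≤ 2 ^ ℓ) × (ℓ ≤ 4 * ℓ₂ * t)
quotient-choice ℓ ℓ₂ 7≤ℓ₂ 2^ℓ₂≤ℓ ℓ<2^1+ℓ₂ = t , 6≤t , t≤ℓ , t^t≤2^ℓ , ℓ≤4ℓ₂t
  where
  open ≤-Reasoning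
  D = 2 * ℓ₂
  instance
    D≢0 : NonZero D
    D≢0 = >-nonZero (≤-trans (s≤s z≤n) (*-monoʳ-≤ 2 7≤ℓ₂))
  t = ℓ / D
  tD≤ℓ : t * D ≤ ℓ
  tD≤ℓ = m/n*n≤m ℓ D
  ℓ<tD+D : ℓ < t * D + D
  ℓ<tD+D = begin-strict
    ℓ             ≡⟨ m≡m%n+[m/n]*n ℓ D ⟩
    ℓ % D + t * D <⟨ +-monoˡ-< (t * D) (m%n<n ℓ D) ⟩
    D + t * D     ≡⟨ +-comm D (t * D) ⟩
    t * D + D     ∎
  6D≤ℓ : 6 * D ≤ ℓ
  6D≤ℓ = begin
    6 * (2 * ℓ₂) ≡⟨ *-comm 6 D ⟩
    2 * ℓ₂ * 6   ≤⟨ *-monoʳ-≤ (2 * ℓ₂) (≤-trans (n≤1+n 6) 7≤ℓ₂) ⟩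
    2 * ℓ₂ * ℓ₂  ≤⟨ square≤pow ℓ₂ 7≤ℓ₂ ⟩
    2 ^ ℓ₂       ≤⟨ 2^ℓ₂≤ℓ ⟩
    ℓ            ∎
  6≤t : 6 ≤ t
  6≤t = ≤-pred (*-cancelʳ-< D 6 (suc t) (≤-<-trans 6D≤ℓ (subst (ℓ <_) (+-comm (t * D) D) ℓ<tD+D)))
  t≤ℓ : t ≤ ℓ
  t≤ℓ = ≤-trans (m≤m*n t D) tD≤ℓ
  1+ℓ₂≤D : suc ℓ₂ ≤ D
  1+ℓ₂≤D = ≤-trans (+-monoˡ-≤ ℓ₂ (≤-trans (s≤s z≤n) 7≤ℓ₂)) (≤-reflexive (cong (ℓ₂ +_) (sym (+-identityʳ ℓ₂))))
  t^t≤2^ℓ : t ^ t ≤ 2 ^ ℓ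
  t^t≤2^ℓ = begin
    t ^ t            ≤⟨ ^-monoˡ-≤ t (<⇒≤ (≤-<-trans t≤ℓ ℓ<2^1+ℓ₂)) ⟩
    (2 ^ suc ℓ₂) ^ t ≡⟨ ^-*-assoc 2 (suc ℓ₂) t ⟩
    2 ^ (suc ℓ₂ * t) ≤⟨ ^-monoʳ-≤ 2 (*-monoˡ-≤ t 1+ℓ₂≤D) ⟩
    2 ^ (D * t)      ≤⟨ ^-monoʳ-≤ 2 (≤-trans (≤-reflexive (*-comm D t)) tD≤ℓ) ⟩
    2 ^ ℓ            ∎
  twoCopies : ∀ t x → t * (2 * x) + t * (2 * x) ≡ 4 * x * t
  twoCopies = solve-∀
  ℓ≤4ℓ₂t : ℓ ≤ 4 * ℓ₂ * t
  ℓ≤4ℓ₂t = begin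
    ℓ             ≤⟨ <⇒≤ ℓ<tD+D ⟩
    t * D + D     ≤⟨ +-monoʳ-≤ (t * D) (m≤n*m D t {{>-nonZero (≤-trans (s≤s z≤n) 6≤t)}}) ⟩
    t * D + t * D ≡⟨ twoCopies t ℓ₂ ⟩
    4 * ℓ₂ * t    ∎

-- A threshold for the ratio m: t ≥ 1 with t! = 16u, 2t² ≤ m, t! ≤ m and ℓ ≤ 4·ℓ₂·t,
-- where ℓ = ⌊log₂ m⌋ and ℓ₂ = ⌊log₂ ℓ⌋; so t is of order log m / log log m.
Threshold : ℕ → Set
Threshold m = Σ ℕ λ t → Σ ℕ λ u → (1 ≤ t) × (t ! ≡ 16 * u) × (1 ≤ u) ×
              (2 * t * t ≤ m) × (t ! ≤ m) × (⌊log₂ m ⌋ ≤ 4 * ⌊log₂ ⌊log₂ m ⌋ ⌋ * t)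

-- For m ≥ 2^128 the quotient choice is a threshold: t ≥ 6 gives 16 ∣ t!, and
-- 2t² ≤ 2ℓ² ≤ 2^ℓ ≤ m, t! ≤ t^t ≤ 2^ℓ ≤ m.
threshold : ∀ m → 2 ^ 128 ≤ m → Threshold m
threshold m 2^128≤m = fromQuotient (quotient-choice ℓ ℓ₂ 7≤ℓ₂ (log₂-lower ℓ 1≤ℓ) (log₂-upper ℓ 1≤ℓ))
  where
  open ≤-Reasoning
  ℓ  = ⌊log₂ m ⌋
  ℓ₂ = ⌊log₂ ℓ ⌋
  128≤ℓ : 128 ≤ ℓ
  128≤ℓ = log₂-≥ 128 m 2^128≤m
  1≤ℓ : 1 ≤ ℓ
  1≤ℓ = ≤-trans (s≤s z≤n) 128≤ℓ
  7≤ℓ₂ : 7 ≤ ℓ₂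
  7≤ℓ₂ = log₂-≥ 7 ℓ 128≤ℓ
  2^ℓ≤m : 2 ^ ℓ ≤ m
  2^ℓ≤m = log₂-lower m (≤-trans (m^n>0 2 128) 2^128≤m)
  fromQuotient : (Σ ℕ λ t → (6 ≤ t) × (t ≤ ℓ) × (t ^ t ≤ 2 ^ ℓ) × (ℓ ≤ 4 * ℓ₂ * t)) → Threshold m
  fromQuotient (t , 6≤t , t≤ℓ , t^t≤2^ℓ , ℓ≤4ℓ₂t) =
    t , proj₁ sixteen∣ , ≤-trans (s≤s z≤n) 6≤t , proj₁ (proj₂ sixteen∣) , proj₂ (proj₂ sixteen∣) ,
    2tt≤m , ≤-trans (factorial≤power t) (≤-trans t^t≤2^ℓ 2^ℓ≤m) , ℓ≤4ℓ₂t
    where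
    sixteen∣ : Σ ℕ λ u → (t ! ≡ 16 * u) × (1 ≤ u)
    sixteen∣ = sixteen∣t! t 6≤t
    2tt≤m : 2 * t * t ≤ m
    2tt≤m = begin
      2 * t * t ≤⟨ *-mono-≤ (*-monoʳ-≤ 2 t≤ℓ) t≤ℓ ⟩
      2 * ℓ * ℓ ≤⟨ square≤pow ℓ (≤-trans (≤ᵇ⇒≤ 7 128 tt) 128≤ℓ) ⟩
      2 ^ ℓ     ≤⟨ 2^ℓ≤m ⟩
      m         ∎

main-bound : ∀ n k → 1 ≤ k → 2 ^ 128 * k ≤ n →
             k * logRatio n k * n ^ n ≤ 2048 * totalTopSum n k * logLogRatio n k
main-bound n k@(suc _) 1≤k 2^128k≤n = bound (threshold m 2^128≤m)
  where
  open ≤-Reasoning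
  m  = n / k
  ℓ  = ⌊log₂ m ⌋
  ℓ₂ = ⌊log₂ ℓ ⌋
  2^128≤m : 2 ^ 128 ≤ m
  2^128≤m = ≤-trans (≤-reflexive (sym (m*n/n≡m (2 ^ 128) k))) (/-monoˡ-≤ k 2^128k≤n)
  m≤n : m ≤ n
  m≤n = m/n≤m n k
  2≤n : 2 ≤ n
  2≤n = ≤-trans (^-monoʳ-≤ 2 {1} {128} (s≤s z≤n)) (≤-trans 2^128≤m m≤n)
  regroup : ∀ k a t M → k * (4 * a * t) * M ≡ 4 * a * (t * k * M)
  regroup = solve-∀
  collect : ∀ a T → 4 * a * (512 * T) ≡ 2048 * T * a
  collect = solve-∀
  bound : Threshold m → k * ℓ * n ^ n ≤ 2048 * totalTopSum n k * ℓ₂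
  bound (t , u , 1≤t , t!≡16u , 1≤u , 2tt≤m , t!≤m , ℓ≤4ℓ₂t) = begin
    k * ℓ * n ^ n                     ≤⟨ *-monoˡ-≤ (n ^ n) (*-monoʳ-≤ k ℓ≤4ℓ₂t) ⟩
    k * (4 * ℓ₂ * t) * n ^ n          ≡⟨ regroup k ℓ₂ t (n ^ n) ⟩
    4 * ℓ₂ * (t * k * n ^ n)          ≤⟨ *-monoʳ-≤ (4 * ℓ₂) second-moment-bound ⟩
    4 * ℓ₂ * (512 * totalTopSum n k)  ≡⟨ collect ℓ₂ (totalTopSum n k) ⟩
    2048 * totalTopSum n k * ℓ₂       ∎
    where
    ku≤n : k * u ≤ n
    ku≤n = begin
      k * u ≤⟨ *-monoʳ-≤ k (≤-trans (m≤n*m u 16) (≤-trans (≤-reflexive (sym t!≡16u)) t!≤m)) ⟩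
      k * m ≡⟨ *-comm k m ⟩
      m * k ≤⟨ m/n*n≤m n k ⟩
      n     ∎
    second-moment-bound : t * k * n ^ n ≤ 512 * totalTopSum n k
    second-moment-bound = topSum-lower n t k u 2≤n 1≤t 1≤k 1≤u t!≡16u (≤-trans 2tt≤m m≤n) ku≤n

lemma5 : Σ ℕ λ a → Σ ℕ λ b → Σ ℕ λ p → Σ ℕ λ q →
           (1 ≤ a) × (1 ≤ b) × (1 ≤ p) × (1 ≤ q) ×
           ((n k : ℕ) → 1 ≤ k → b * k ≤ a * n →
             p * k * logRatio n k * n ^ n ≤ q * totalTopSum n k * logLogRatio n k)
lemma5 = 1 , 2 ^ 128 , 1 , 2048 , ≤-refl , m^n>0 2 128 , ≤-refl , s≤s z≤n , bound
  where
  bound : (n k : ℕ) → 1 ≤ k → 2 ^ 128 * k ≤ 1 * n →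
          1 * k * logRatio n k * n ^ n ≤ 2048 * totalTopSum n k * logLogRatio n k
  bound n k 1≤k 2^128k≤n =
    subst (λ x → x * logRatio n k * n ^ n ≤ 2048 * totalTopSum n k * logLogRatio n k) (sym (*-identityˡ k))
          (main-bound n k 1≤k (subst (2 ^ 128 * k ≤_) (*-identityˡ n) 2^128k≤n))
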